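{- Let $l \geq 1$ be an integer and let $G$ be a finite connected graph. Let $H_1$ be the graph obtained from a path $x_1 - x_2 - \cdots - x_{l+1}$ on $l+1$ vertices by adding two new vertices $a, b$, each adjacent only to $x_1$ (so $a$ and $b$ are non-adjacent). Let $H_2$ be the graph obtained from $H_1$ by adding the edge $ab$. If $G$ contains neither $H_1$ nor $H_2$ as an induced subgraph, then $c(G) \leq l+1$.
   Context: Cops and Robber game on a finite connected graph $G$: a player controlling $k$ cops places them on vertices (not necessarily distinct), then the robber is placed on a vertex; then the cops and the robber alternately move, each piece in its turn either moving to an adjacent vertex or staying put. The cops win if after finitely many rounds some cop occupies the same vertex as the robber; both sides have complete information. The cop number $c(G)$ is the minimum number of cops that can guarantee capture of the robber on $G$. -}

module Defs where

open import Data.Nat using (ℕ; zero; suc; _+_; _≤_; _≡ᵇ_; _≤ᵇ_)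
open import Data.Bool using (Bool; true; false; _∨_; _∧_)
open import Data.Fin using (Fin; toℕ)
open import Data.Product using (Σ; _×_; ∃; ∃-syntax)
open import Data.Sum using (_⊎_)
open import Relation.Binary.PropositionalEquality using (_≡_)
open import Function.Definitions using (Injective)

record SimpleGraph (n : ℕ) : Set where
  field
    adj    : Fin n → Fin n → Bool
    sym    : ∀ u v → adj u v ≡ adj v u
    irrefl : ∀ v → adj v v ≡ false
open SimpleGraph public

module _ {n : ℕ} (G : SimpleGraph n) where

  Edge : Fin n → Fin n → Set
  Edge u v = adj G u v ≡ true

  Step : Fin n → Fin n → Set
  Step u v = (u ≡ v) ⊎ Edge u v

  data Reachable : Fin n → Fin n → Set where
    here : ∀ {u} → Reachable u u
    step : ∀ {u v w} → Edge u v → Reachable v w → Reachable u w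

  Connected : Set
  Connected = ∀ u v → Reachable u v

  InducedSub : {m : ℕ} → (Fin m → Fin m → Bool) → Set
  InducedSub {m} hadj = Σ (Fin m → Fin n) λ f →
    Injective _≡_ _≡_ f × (∀ i j → adj G (f i) (f j) ≡ hadj i j)

  Caught : {k : ℕ} → (Fin k → Fin n) → Fin n → Set
  Caught {k} c r = ∃[ i ] c i ≡ r

  -- Inductively: positions from which the cops can force capture in finitely many rounds.
  -- CopTurn: cops are to move; RobTurn: robber is to move.
  data CopTurn {k : ℕ} : (Fin k → Fin n) → Fin n → Set
  data RobTurn {k : ℕ} : (Fin k → Fin n) → Fin n → Set

  data CopTurn {k} where
    caughtC : ∀ {c r} → Caught c r → CopTurn c r
    moveC   : ∀ {c r} (c' : Fin k → Fin n) → (∀ i → Step (c i) (c' i)) →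
              RobTurn c' r → CopTurn c r

  data RobTurn {k} where
    caughtR : ∀ {c r} → Caught c r → RobTurn c r
    moveR   : ∀ {c r} → (∀ r' → Step r r' → CopTurn c r') → RobTurn c r

  -- k cops can guarantee capture: cops are placed, then robber is placed, then cops move first.
  CopsWin : ℕ → Set
  CopsWin k = Σ (Fin k → Fin n) λ c → ∀ r → CopTurn c r

  CopNumber≤ : ℕ → Set
  CopNumber≤ k = ∃[ j ] (j ≤ k × CopsWin j)

-- The graphs H₁, H₂ on Fin (l + 3): vertex t (0 ≤ t ≤ l) is x_{t+1},
-- vertex l+1 is a, vertex l+2 is b.
H1edgeDir : ℕ → ℕ → ℕ → Bool
H1edgeDir l p q = ((suc p ≡ᵇ q) ∧ (q ≤ᵇ l))
                ∨ ((p ≡ᵇ 0) ∧ ((q ≡ᵇ suc l) ∨ (q ≡ᵇ suc (suc l))))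

H2edgeDir : ℕ → ℕ → ℕ → Bool
H2edgeDir l p q = H1edgeDir l p q ∨ ((p ≡ᵇ suc l) ∧ (q ≡ᵇ suc (suc l)))

H1 : (l : ℕ) → Fin (l + 3) → Fin (l + 3) → Bool
H1 l i j = H1edgeDir l (toℕ i) (toℕ j) ∨ H1edgeDir l (toℕ j) (toℕ i)

H2 : (l : ℕ) → Fin (l + 3) → Fin (l + 3) → Bool
H2 l i j = H2edgeDir l (toℕ i) (toℕ j) ∨ H2edgeDir l (toℕ j) (toℕ i)

-- A lead cop chases the robber inside a shrinking territory D while l followers are
-- posted one by one. Each round the lead cop steps from c to the first vertex w of N(c)
-- on a walk in D starting at the robber, and D loses N[c]; the exits of D stay watched
-- because a newly posted follower stays behind at c. The lead cop's trail is an induced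
-- path whose vertices behind its head are at distance at least 2 from D. Once all
-- followers are posted, a neighbour y ≠ w of c in D would induce, together with w and
-- the l + 1 most recent vertices of the trail, a copy of H₁ or H₂; so no new guard is needed.
-- As D strictly shrinks, the robber is eventually caught.
module Submission where

open import Defs renaming (sym to adj-sym)
open import Algebra using (CommutativeMonoid)
open import Data.Bool using (Bool; true; false; _∨_; _∧_)
import Data.Bool as Bool
open import Data.Bool.Properties using (∨-identityʳ; ∧-identityʳ; ∧-zeroʳ; ∨-comm; ∨-commutativeMonoid; T-≡)
open import Algebra.Properties.CommutativeSemigroup (CommutativeMonoid.commutativeSemigroup ∨-commutativeMonoid) using (interchange)
open import Data.Empty using (⊥-elim)
open import Data.Fin using (Fin; zero; suc; toℕ; fromℕ<; _≟_)
open import Data.Fin.Properties using (toℕ<n; toℕ-injective; toℕ-fromℕ<; any?)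
open import Data.Fin.Subset using (Subset; _∈_; _∉_; _⊂_; _∩_; ∁; ⊤; ∣_∣)
open import Data.Fin.Subset.Properties using (_∈?_; ∈⊤; x∈p∩q⁺; x∈p∩q⁻; x∉p⇒x∈∁p; x∈∁p⇒x∉p; p∩q⊆p; p⊂q⇒∣p∣<∣q∣)
open import Data.Nat using (ℕ; zero; suc; _+_; _≤_; _<_; z≤n; s≤s; _≡ᵇ_; _≤ᵇ_; _≤?_; _<?_)
open import Data.Nat.Induction using (<-wellFounded)
open import Data.Nat.Properties using (≤-trans; ≤-refl; ≤-reflexive; <⇒≢; <⇒≱; ≮⇒≥; ≰⇒>; n≤1+n; +-comm; ≡ᵇ⇒≡; ≡⇒≡ᵇ; ≤ᵇ⇒≤; ≤⇒≤ᵇ)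
open import Data.Product using (_×_; _,_; ∃-syntax; proj₁; proj₂)
open import Data.Sum using (_⊎_; inj₁; inj₂; [_,_])
open import Data.Vec using (tabulate)
open import Data.Vec.Properties using (lookup∘tabulate; []=⇒lookup; lookup⇒[]=)
open import Data.Vec.Functional using (_∷_; updateAt)
open import Data.Vec.Functional.Properties using (updateAt-updates; updateAt-minimal)
open import Function using (_∘_; const)
open import Function.Bundles using (Equivalence)
open import Induction.WellFounded using (Acc; acc)
open import Relation.Binary.Construct.Closure.ReflexiveTransitive using (Star; ε; _◅_)
open import Relation.Binary.PropositionalEquality using (_≡_; _≢_; refl; sym; trans; cong; cong₂; subst; module ≡-Reasoning)
open import Relation.Nullary using (¬_; Dec; yes; no)
open import Relation.Nullary.Decidable using (_⊎-dec_; isYes; toWitness; fromWitness)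

≡true⇐T : ∀ {b} → Bool.T b → b ≡ true
≡true⇐T = Equivalence.to T-≡

≡false⇐¬T : ∀ {b} → ¬ Bool.T b → b ≡ false
≡false⇐¬T {false} _ = refl
≡false⇐¬T {true} ¬t = ⊥-elim (¬t _)

≡ᵇ-refl : ∀ m → (m ≡ᵇ m) ≡ true
≡ᵇ-refl m = ≡true⇐T (≡⇒≡ᵇ m m refl)

≢⇒≡ᵇ≡false : ∀ {m n} → m ≢ n → (m ≡ᵇ n) ≡ false
≢⇒≡ᵇ≡false m≢n = ≡false⇐¬T (m≢n ∘ ≡ᵇ⇒≡ _ _)

≤⇒≤ᵇ≡true : ∀ {m n} → m ≤ n → (m ≤ᵇ n) ≡ true
≤⇒≤ᵇ≡true = ≡true⇐T ∘ ≤⇒≤ᵇ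

>⇒≤ᵇ≡false : ∀ {m n} → n < m → (m ≤ᵇ n) ≡ false
>⇒≤ᵇ≡false n<m = ≡false⇐¬T (<⇒≱ n<m ∘ ≤ᵇ⇒≤ _ _)

≡ᵇ∧≤ᵇ≡false : ∀ {l m} → l < m → ∀ q → ((m ≡ᵇ q) ∧ (q ≤ᵇ l)) ≡ false
≡ᵇ∧≤ᵇ≡false {l} l<m q with q ≤? l
... | yes q≤l rewrite ≢⇒≡ᵇ≡false (<⇒≢ (≤-trans (s≤s q≤l) l<m) ∘ sym) = refl
... | no q≰l rewrite >⇒≤ᵇ≡false (≰⇒> q≰l) = ∧-zeroʳ _

prepend : ∀ {A : Set} → A → (ℕ → A) → ℕ → A
prepend w s zero = w
prepend w s (suc p) = s p

pathAdj : ℕ → ℕ → Bool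
pathAdj p q = (suc p ≡ᵇ q) ∨ (suc q ≡ᵇ p)

data ForkIndex (l : ℕ) : ℕ → Set where
  spine : ∀ {p} → p ≤ l → ForkIndex l p
  leafA : ForkIndex l (suc l)
  leafB : ForkIndex l (suc (suc l))

forkIndex : ∀ l {p} → p < l + 3 → ForkIndex l p
forkIndex zero {0} _ = spine z≤n
forkIndex zero {1} _ = leafA
forkIndex zero {2} _ = leafB
forkIndex zero {suc (suc (suc _))} (s≤s (s≤s (s≤s ())))
forkIndex (suc l) {zero} _ = spine z≤n
forkIndex (suc l) {suc p} (s≤s p<l+3) = shift (forkIndex l p<l+3)
  where
  shift : ForkIndex l p → ForkIndex (suc l) (suc p)
  shift (spine p≤l) = spine (s≤s p≤l)
  shift leafA = leafA
  shift leafB = leafB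

module _ {l : ℕ} where

  forkArrow : ∀ {p q} → ForkIndex l p → ForkIndex l q → Bool
  forkArrow (spine {p} _) (spine {q} _) = suc p ≡ᵇ q
  forkArrow (spine {p} _) leafA = p ≡ᵇ 0
  forkArrow (spine {p} _) leafB = p ≡ᵇ 0
  forkArrow leafA _ = false
  forkArrow leafB _ = false

  leafArrow : ∀ {p q} → ForkIndex l p → ForkIndex l q → Bool
  leafArrow leafA leafB = true
  leafArrow _ _ = false

  forkAdj : ∀ {p q} → Bool → ForkIndex l p → ForkIndex l q → Bool
  forkAdj ab ip iq = ((leafArrow ip iq ∨ leafArrow iq ip) ∧ ab) ∨ (forkArrow ip iq ∨ forkArrow iq ip)

  H1edgeDir-forkArrow : ∀ {p q} (ip : ForkIndex l p) (iq : ForkIndex l q) → H1edgeDir l p q ≡ forkArrow ip iq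
  H1edgeDir-forkArrow (spine {p} p≤l) (spine {q} q≤l)
    rewrite ≤⇒≤ᵇ≡true q≤l | ≢⇒≡ᵇ≡false (<⇒≢ (s≤s q≤l)) | ≢⇒≡ᵇ≡false (<⇒≢ (s≤s (≤-trans q≤l (n≤1+n l))))
          | ∧-identityʳ (suc p ≡ᵇ q) | ∧-zeroʳ (p ≡ᵇ 0) = ∨-identityʳ _
  H1edgeDir-forkArrow (spine {p} _) leafA
    rewrite >⇒≤ᵇ≡false (≤-refl {suc l}) | ∧-zeroʳ (p ≡ᵇ l) | ≡ᵇ-refl l = ∧-identityʳ _
  H1edgeDir-forkArrow (spine {p} _) leafB
    rewrite >⇒≤ᵇ≡false (n≤1+n (suc l)) | ∧-zeroʳ (p ≡ᵇ suc l) | ≢⇒≡ᵇ≡false (<⇒≢ (≤-refl {suc l}) ∘ sym) | ≡ᵇ-refl l = ∧-identityʳ _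
  H1edgeDir-forkArrow {q = q} leafA _ rewrite ≡ᵇ∧≤ᵇ≡false (n≤1+n (suc l)) q = refl
  H1edgeDir-forkArrow {q = q} leafB _ rewrite ≡ᵇ∧≤ᵇ≡false (≤-trans (n≤1+n (suc l)) (n≤1+n _)) q = refl

  H2edgeDir-forkArrow : ∀ {p q} (ip : ForkIndex l p) (iq : ForkIndex l q) →
                        H2edgeDir l p q ≡ forkArrow ip iq ∨ leafArrow ip iq
  H2edgeDir-forkArrow ip iq = cong₂ _∨_ (H1edgeDir-forkArrow ip iq) (leafEdge ip iq)
    where
    leafEdge : ∀ {p q} (ip : ForkIndex l p) (iq : ForkIndex l q) →
               ((p ≡ᵇ suc l) ∧ (q ≡ᵇ suc (suc l))) ≡ leafArrow ip iq
    leafEdge (spine p≤l) _ rewrite ≢⇒≡ᵇ≡false (<⇒≢ (s≤s p≤l)) = refl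
    leafEdge leafA (spine q≤l) rewrite ≡ᵇ-refl l | ≢⇒≡ᵇ≡false (<⇒≢ (s≤s (≤-trans q≤l (n≤1+n l)))) = refl
    leafEdge leafA leafA rewrite ≡ᵇ-refl l | ≢⇒≡ᵇ≡false (<⇒≢ (≤-refl {suc l})) = refl
    leafEdge leafA leafB rewrite ≡ᵇ-refl l = refl
    leafEdge leafB _ rewrite ≢⇒≡ᵇ≡false (<⇒≢ (≤-refl {suc l}) ∘ sym) = refl

  forkIndexOf : (i : Fin (l + 3)) → ForkIndex l (toℕ i)
  forkIndexOf i = forkIndex l (toℕ<n i)

  H1≡forkAdj : ∀ i j → H1 l i j ≡ forkAdj false (forkIndexOf i) (forkIndexOf j)
  H1≡forkAdj i j rewrite ∧-zeroʳ (leafArrow (forkIndexOf i) (forkIndexOf j) ∨ leafArrow (forkIndexOf j) (forkIndexOf i)) =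
    cong₂ _∨_ (H1edgeDir-forkArrow (forkIndexOf i) (forkIndexOf j)) (H1edgeDir-forkArrow (forkIndexOf j) (forkIndexOf i))

  H2≡forkAdj : ∀ i j → H2 l i j ≡ forkAdj true (forkIndexOf i) (forkIndexOf j)
  H2≡forkAdj i j = begin
    H2edgeDir l (toℕ i) (toℕ j) ∨ H2edgeDir l (toℕ j) (toℕ i)
      ≡⟨ cong₂ _∨_ (H2edgeDir-forkArrow ip iq) (H2edgeDir-forkArrow iq ip) ⟩
    (forkArrow ip iq ∨ leafArrow ip iq) ∨ (forkArrow iq ip ∨ leafArrow iq ip)
      ≡⟨ interchange (forkArrow ip iq) (leafArrow ip iq) (forkArrow iq ip) (leafArrow iq ip) ⟩
    (forkArrow ip iq ∨ forkArrow iq ip) ∨ (leafArrow ip iq ∨ leafArrow iq ip)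
      ≡⟨ ∨-comm (forkArrow ip iq ∨ forkArrow iq ip) _ ⟩
    (leafArrow ip iq ∨ leafArrow iq ip) ∨ (forkArrow ip iq ∨ forkArrow iq ip)
      ≡⟨ cong (_∨ (forkArrow ip iq ∨ forkArrow iq ip)) (sym (∧-identityʳ (leafArrow ip iq ∨ leafArrow iq ip))) ⟩
    forkAdj true ip iq ∎
    where
    open ≡-Reasoning
    ip = forkIndexOf i
    iq = forkIndexOf j

module _ {n : ℕ} (G : SimpleGraph n) where

  Edge-sym : ∀ {u v} → Edge G u v → Edge G v u
  Edge-sym {u} {v} e = trans (adj-sym G v u) e

  Edge⇒≢ : ∀ {u v} → Edge G u v → u ≢ v
  Edge⇒≢ {u} e refl with trans (sym e) (irrefl G u)
  ... | ()

  ¬Step⇒nonadjacent : ∀ {u v} → ¬ Step G u v → adj G u v ≡ false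
  ¬Step⇒nonadjacent ¬st = ≡false⇐¬T (¬st ∘ inj₂ ∘ ≡true⇐T)

  Step⇒Edge : ∀ {u v} → Step G u v → u ≢ v → Edge G u v
  Step⇒Edge (inj₁ u≡v) u≢v = ⊥-elim (u≢v u≡v)
  Step⇒Edge (inj₂ e) _ = e

  step? : ∀ u v → Dec (Step G u v)
  step? u v = (u ≟ v) ⊎-dec (adj G u v Bool.≟ true)

  record IsInducedPath (k : ℕ) (s : ℕ → Fin n) : Set where
    field
      adjacency : ∀ {p q} → p ≤ k → q ≤ k → adj G (s p) (s q) ≡ pathAdj p q
      injective : ∀ {p q} → p ≤ k → q ≤ k → s p ≡ s q → p ≡ q

  FarFromTail : ℕ → (ℕ → Fin n) → Fin n → Set
  FarFromTail k s x = ∀ {p} → p < k → ¬ Step G (s (suc p)) x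

  IsInducedPath-zero : ∀ s → IsInducedPath 0 s
  IsInducedPath-zero s = record
    { adjacency = λ { z≤n z≤n → irrefl G (s 0) }
    ; injective = λ { z≤n z≤n _ → refl }
    }

  IsInducedPath-≤ : ∀ {j k s} → j ≤ k → IsInducedPath k s → IsInducedPath j s
  IsInducedPath-≤ j≤k P = record
    { adjacency = λ p≤j q≤j → adjacency (≤-trans p≤j j≤k) (≤-trans q≤j j≤k)
    ; injective = λ p≤j q≤j → injective (≤-trans p≤j j≤k) (≤-trans q≤j j≤k)
    }
    where open IsInducedPath P

  FarFromTail-≤ : ∀ {j k s x} → j ≤ k → FarFromTail k s x → FarFromTail j s x
  FarFromTail-≤ j≤k far p<j = far (≤-trans p<j j≤k)

  attached≢ : ∀ {k s x} → Edge G (s 0) x → FarFromTail k s x → ∀ {p} → p ≤ k → s p ≢ x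
  attached≢ root far {zero} _ = Edge⇒≢ root
  attached≢ root far {suc p} p<k = far p<k ∘ inj₁

  adj-attached : ∀ {k s x} → Edge G (s 0) x → FarFromTail k s x → ∀ {p} → p ≤ k → adj G (s p) x ≡ (p ≡ᵇ 0)
  adj-attached root far {zero} _ = root
  adj-attached root far {suc p} p<k = ¬Step⇒nonadjacent (far p<k)

  IsInducedPath-prepend : ∀ {k s w} → IsInducedPath k s → Edge G w (s 0) → FarFromTail k s w →
                          IsInducedPath (suc k) (prepend w s)
  IsInducedPath-prepend {k} {s} {w} P root far = record { adjacency = adjacency′ ; injective = injective′ }
    where
    open IsInducedPath P
    adjacency′ : ∀ {p q} → p ≤ suc k → q ≤ suc k → adj G (prepend w s p) (prepend w s q) ≡ pathAdj p q
    adjacency′ {zero} {zero} _ _ = irrefl G w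
    adjacency′ {zero} {suc zero} _ _ = root
    adjacency′ {zero} {suc (suc q)} _ (s≤s q<k) = trans (adj-sym G w (s (suc q))) (¬Step⇒nonadjacent (far q<k))
    adjacency′ {suc zero} {zero} _ _ = Edge-sym root
    adjacency′ {suc (suc p)} {zero} (s≤s p<k) _ = ¬Step⇒nonadjacent (far p<k)
    adjacency′ {suc p} {suc q} (s≤s p≤k) (s≤s q≤k) = adjacency p≤k q≤k
    injective′ : ∀ {p q} → p ≤ suc k → q ≤ suc k → prepend w s p ≡ prepend w s q → p ≡ q
    injective′ {zero} {zero} _ _ _ = refl
    injective′ {zero} {suc q} _ (s≤s q≤k) w≡sq = ⊥-elim (attached≢ {s = s} (Edge-sym root) far q≤k (sym w≡sq))
    injective′ {suc p} {zero} (s≤s p≤k) _ sp≡w = ⊥-elim (attached≢ {s = s} (Edge-sym root) far p≤k sp≡w)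
    injective′ {suc p} {suc q} (s≤s p≤k) (s≤s q≤k) sp≡sq = cong suc (injective p≤k q≤k sp≡sq)

  FarFromTail-prepend : ∀ {k s w x} → ¬ Step G (s 0) x → FarFromTail k s x → FarFromTail (suc k) (prepend w s) x
  FarFromTail-prepend ¬s₀x far {zero} _ = ¬s₀x
  FarFromTail-prepend ¬s₀x far {suc p} (s≤s p<k) = far p<k

  record IsFork (l : ℕ) (s : ℕ → Fin n) (a b : Fin n) : Set where
    field
      path   : IsInducedPath l s
      root-a : Edge G (s 0) a
      root-b : Edge G (s 0) b
      a≢b    : a ≢ b
      far-a  : FarFromTail l s a
      far-b  : FarFromTail l s b

  module ForkEmbedding {l s a b} (F : IsFork l s a b) where
    open IsFork F
    open IsInducedPath path

    vertex : ∀ {p} → ForkIndex l p → Fin n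
    vertex (spine {p} _) = s p
    vertex leafA = a
    vertex leafB = b

    vertex-injective : ∀ {p q} (ip : ForkIndex l p) (iq : ForkIndex l q) → vertex ip ≡ vertex iq → p ≡ q
    vertex-injective (spine p≤l) (spine q≤l) eq = injective p≤l q≤l eq
    vertex-injective (spine p≤l) leafA eq = ⊥-elim (attached≢ {s = s} root-a far-a p≤l eq)
    vertex-injective (spine p≤l) leafB eq = ⊥-elim (attached≢ {s = s} root-b far-b p≤l eq)
    vertex-injective leafA (spine q≤l) eq = ⊥-elim (attached≢ {s = s} root-a far-a q≤l (sym eq))
    vertex-injective leafB (spine q≤l) eq = ⊥-elim (attached≢ {s = s} root-b far-b q≤l (sym eq))
    vertex-injective leafA leafA _ = refl
    vertex-injective leafB leafB _ = refl
    vertex-injective leafA leafB eq = ⊥-elim (a≢b eq)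
    vertex-injective leafB leafA eq = ⊥-elim (a≢b (sym eq))

    adj-vertex : ∀ {p q} (ip : ForkIndex l p) (iq : ForkIndex l q) → adj G (vertex ip) (vertex iq) ≡ forkAdj (adj G a b) ip iq
    adj-vertex (spine p≤l) (spine q≤l) = adjacency p≤l q≤l
    adj-vertex (spine p≤l) leafA = trans (adj-attached {s = s} root-a far-a p≤l) (sym (∨-identityʳ _))
    adj-vertex (spine p≤l) leafB = trans (adj-attached {s = s} root-b far-b p≤l) (sym (∨-identityʳ _))
    adj-vertex leafA (spine q≤l) = trans (adj-sym G a _) (adj-attached {s = s} root-a far-a q≤l)
    adj-vertex leafB (spine q≤l) = trans (adj-sym G b _) (adj-attached {s = s} root-b far-b q≤l)
    adj-vertex leafA leafA = irrefl G a
    adj-vertex leafB leafB = irrefl G b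
    adj-vertex leafA leafB = sym (∨-identityʳ _)
    adj-vertex leafB leafA = trans (adj-sym G b a) (sym (∨-identityʳ _))

    embedding : Fin (l + 3) → Fin n
    embedding = vertex ∘ forkIndexOf

    embedding-injective : ∀ {i j} → embedding i ≡ embedding j → i ≡ j
    embedding-injective {i} {j} = toℕ-injective ∘ vertex-injective (forkIndexOf i) (forkIndexOf j)

    adj-embedding : ∀ {t} → adj G a b ≡ t → ∀ i j → adj G (embedding i) (embedding j) ≡ forkAdj t (forkIndexOf i) (forkIndexOf j)
    adj-embedding ab≡t i j = trans (adj-vertex (forkIndexOf i) (forkIndexOf j)) (cong (λ t → forkAdj t (forkIndexOf i) (forkIndexOf j)) ab≡t)

  IsFork⇒InducedSub : ∀ {l s a b} → IsFork l s a b → InducedSub G (H1 l) ⊎ InducedSub G (H2 l)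
  IsFork⇒InducedSub {l} {a = a} {b} F = byLeafAdjacency (adj G a b) refl
    where
    open ForkEmbedding F
    byLeafAdjacency : ∀ t → adj G a b ≡ t → InducedSub G (H1 l) ⊎ InducedSub G (H2 l)
    byLeafAdjacency false ab = inj₁ (embedding , embedding-injective , λ i j → trans (adj-embedding ab i j) (sym (H1≡forkAdj i j)))
    byLeafAdjacency true ab = inj₂ (embedding , embedding-injective , λ i j → trans (adj-embedding ab i j) (sym (H2≡forkAdj i j)))

  N[_] : Fin n → Subset n
  N[ c ] = tabulate (λ x → isYes (step? c x))

  ∈N[]⇒Step : ∀ {c x} → x ∈ N[ c ] → Step G c x
  ∈N[]⇒Step {c} {x} x∈N = toWitness (Equivalence.from T-≡ (trans (sym (lookup∘tabulate _ x)) ([]=⇒lookup x∈N)))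

  Step⇒∈N[] : ∀ {c x} → Step G c x → x ∈ N[ c ]
  Step⇒∈N[] {c} {x} c~x = lookup⇒[]= x N[ c ] (trans (lookup∘tabulate _ x) (≡true⇐T (fromWitness c~x)))

  ∈∖N[]⁺ : ∀ {D c x} → x ∈ D → ¬ Step G c x → x ∈ D ∩ ∁ N[ c ]
  ∈∖N[]⁺ x∈D ¬c~x = x∈p∩q⁺ (x∈D , x∉p⇒x∈∁p (¬c~x ∘ ∈N[]⇒Step))

  ∈∖N[]⁻ : ∀ {D c x} → x ∈ D ∩ ∁ N[ c ] → x ∈ D × ¬ Step G c x
  ∈∖N[]⁻ {D} x∈D∖N with x∈p∩q⁻ D _ x∈D∖N
  ... | x∈D , x∈∁N = x∈D , x∈∁p⇒x∉p x∈∁N ∘ Step⇒∈N[]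

  Walk : Subset n → Fin n → Fin n → Set
  Walk D = Star (λ u v → Edge G u v × v ∈ D)

  Reachable⇒Walk : ∀ {u v} → Reachable G u v → Walk ⊤ u v
  Reachable⇒Walk here = ε
  Reachable⇒Walk (step e rest) = (e , ∈⊤) ◅ Reachable⇒Walk rest

  record Entry (D : Subset n) (c r : Fin n) : Set where
    field
      v w  : Fin n
      walk : Walk (D ∩ ∁ N[ c ]) r v
      v-w  : Edge G v w
      w∈D  : w ∈ D
      c-w  : Edge G c w

  firstEntry : ∀ {D c r x} → Walk D r x → Step G c x → ¬ Step G c r → Entry D c r
  firstEntry ε c~x ¬c~r = ⊥-elim (¬c~r c~x)
  firstEntry {c = c} {r} (_◅_ {j = u} (r-u , u∈D) rest) c~x ¬c~r with step? c u
  ... | yes c~u = record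
    { v = r ; w = u ; walk = ε ; v-w = r-u ; w∈D = u∈D
    ; c-w = Step⇒Edge c~u λ { refl → ¬c~r (inj₂ (Edge-sym r-u)) } }
  ... | no ¬c~u = record { v = v ; w = w ; walk = (r-u , ∈∖N[]⁺ u∈D ¬c~u) ◅ walk ; v-w = v-w ; w∈D = w∈D ; c-w = c-w }
    where open Entry (firstEntry rest c~x ¬c~u)

  Near : ∀ {m} → (Fin m → Fin n) → Fin n → Set
  Near cops y = ∃[ i ] Step G (cops i) y

  near? : ∀ {m} (cops : Fin m → Fin n) y → Dec (Near cops y)
  near? cops y = any? (λ i → step? (cops i) y)

  capture : ∀ {m} {cops : Fin m → Fin n} {r} → Near cops r → CopTurn G cops r
  capture {cops = cops} {r} (i , i~r) = moveC (updateAt cops i (const r)) legal (caughtR (i , updateAt-updates i cops))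
    where
    legal : ∀ j → Step G (cops j) (updateAt cops i (const r) j)
    legal j with j ≟ i
    ... | yes refl = subst (Step G (cops j)) (sym (updateAt-updates j cops)) i~r
    ... | no j≢i = inj₁ (sym (updateAt-minimal j i cops j≢i))

  module Strategy (l : ℕ) (forkFree : ¬ (InducedSub G (H1 l) ⊎ InducedSub G (H2 l))) where

    Guarded : ℕ → (Fin l → Fin n) → Fin n → Set
    Guarded k g y = ∃[ i ] toℕ i < k × Step G (g i) y

    -- The lead cop stands at the head s 0 of its trail s; followers with index ≥ k
    -- are not posted yet and walk with it.
    record Invariant (k : ℕ) (g : Fin l → Fin n) (D : Subset n) (s : ℕ → Fin n) (r : Fin n) : Set where
      field
        k≤l         : k ≤ l
        idle        : ∀ i → k ≤ toℕ i → g i ≡ s 0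
        path        : IsInducedPath k s
        far         : ∀ {x} → x ∈ D → FarFromTail k s x
        exits       : ∀ {x y} → x ∈ D → Edge G x y → y ∉ D → Guarded k g y ⊎ y ≡ s 0
        robber∈D    : r ∈ D
        robber-walk : ∃[ x ] Walk D r x × Step G (s 0) x

    record FollowerMove (k : ℕ) (g : Fin l → Fin n) (c w : Fin n) (D : Subset n) : Set where
      field
        k′         : ℕ
        g′         : Fin l → Fin n
        k′≤l       : k′ ≤ l
        k′≤1+k     : k′ ≤ suc k
        steps      : ∀ i → Step G (g i) (g′ i)
        arrive     : ∀ i → k′ ≤ toℕ i → g′ i ≡ w
        keep-guard : ∀ {y} → Guarded k g y → Guarded k′ g′ y
        guard-lead : ∀ {y} → y ∈ D → Edge G c y → Guarded k′ g′ y ⊎ y ≡ w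

    placeFollower : ∀ {k g c w D} → k < l → (∀ i → k ≤ toℕ i → g i ≡ c) → Edge G c w → FollowerMove k g c w D
    placeFollower {k} {g} {c} {w} {D} k<l idle c-w = record
      { k′ = suc k ; g′ = g′ ; k′≤l = k<l ; k′≤1+k = ≤-refl
      ; steps = steps ; arrive = arrive ; keep-guard = keep-guard ; guard-lead = guard-lead }
      where
      g′ : Fin l → Fin n
      g′ i with toℕ i ≤? k
      ... | yes _ = g i
      ... | no _ = w

      steps : ∀ i → Step G (g i) (g′ i)
      steps i with toℕ i ≤? k
      ... | yes _ = inj₁ refl
      ... | no i≰k = inj₂ (subst (λ z → Edge G z w) (sym (idle i (≤-trans (n≤1+n k) (≰⇒> i≰k)))) c-w)

      arrive : ∀ i → suc k ≤ toℕ i → g′ i ≡ w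
      arrive i k<i with toℕ i ≤? k
      ... | yes i≤k = ⊥-elim (<⇒≱ k<i i≤k)
      ... | no _ = refl

      stays : ∀ i → toℕ i ≤ k → g′ i ≡ g i
      stays i i≤k with toℕ i ≤? k
      ... | yes _ = refl
      ... | no i≰k = ⊥-elim (i≰k i≤k)

      keep-guard : ∀ {y} → Guarded k g y → Guarded (suc k) g′ y
      keep-guard {y} (i , i<k , i~y) = i , ≤-trans i<k (n≤1+n k) , subst (λ z → Step G z y) (sym (stays i (≤-trans (n≤1+n _) i<k))) i~y

      iₖ : Fin l
      iₖ = fromℕ< k<l

      guard-lead : ∀ {y} → y ∈ D → Edge G c y → Guarded (suc k) g′ y ⊎ y ≡ w
      guard-lead {y} _ c-y = inj₁ (iₖ , s≤s (≤-reflexive (toℕ-fromℕ< k<l)) , inj₂ (subst (λ z → Edge G z y) (sym iₖ-at-c) c-y))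
        where
        iₖ-at-c : g′ iₖ ≡ c
        iₖ-at-c = trans (stays iₖ (≤-reflexive (toℕ-fromℕ< k<l))) (idle iₖ (≤-reflexive (sym (toℕ-fromℕ< k<l))))

    -- Once all l followers are placed, a second neighbour y ≠ w of the lead cop in D
    -- would hang with w off the root of the induced path s₀ … s_l: a forbidden fork.
    holdFollowers : ∀ {k g s w D} → k ≤ l → l ≤ k → IsInducedPath k s → (∀ {x} → x ∈ D → FarFromTail k s x) →
                    w ∈ D → Edge G (s 0) w → FollowerMove k g (s 0) w D
    holdFollowers {k} {g} {s} {w} {D} k≤l l≤k path far w∈D c-w = record
      { k′ = k ; g′ = g ; k′≤l = k≤l ; k′≤1+k = n≤1+n k
      ; steps = λ _ → inj₁ refl ; arrive = λ i k≤i → ⊥-elim (<⇒≱ (toℕ<n i) (≤-trans l≤k k≤i))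
      ; keep-guard = λ guarded → guarded ; guard-lead = guard-lead }
      where
      guard-lead : ∀ {y} → y ∈ D → Edge G (s 0) y → Guarded k g y ⊎ y ≡ w
      guard-lead {y} y∈D c-y with y ≟ w
      ... | yes y≡w = inj₂ y≡w
      ... | no y≢w = ⊥-elim (forkFree (IsFork⇒InducedSub record
        { path = IsInducedPath-≤ l≤k path ; root-a = c-y ; root-b = c-w ; a≢b = y≢w
        ; far-a = FarFromTail-≤ {s = s} l≤k (far y∈D) ; far-b = FarFromTail-≤ {s = s} l≤k (far w∈D) }))

    module Round {k g D s r} (I : Invariant k g D s r) (escaped : ¬ Near (s 0 ∷ g) r) where
      open Invariant I
      open Entry (firstEntry (proj₁ (proj₂ robber-walk)) (proj₂ (proj₂ robber-walk)) (escaped ∘ (zero ,_)))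

      move : FollowerMove k g (s 0) w D
      move with k <? l
      ... | yes k<l = placeFollower k<l idle c-w
      ... | no k≮l = holdFollowers k≤l (≮⇒≥ k≮l) path far w∈D c-w
      open FollowerMove move

      D′ : Subset n
      D′ = D ∩ ∁ N[ s 0 ]

      cops′ : Fin (suc l) → Fin n
      cops′ = w ∷ g′

      cops-step : ∀ i → Step G ((s 0 ∷ g) i) (cops′ i)
      cops-step zero = inj₂ c-w
      cops-step (suc i) = steps i

      shrinks : D′ ⊂ D
      shrinks = p∩q⊆p D _ , w , w∈D , λ w∈D′ → proj₂ (∈∖N[]⁻ w∈D′) (inj₂ c-w)

      watched-near : ∀ {y} → Guarded k′ g′ y ⊎ y ≡ w → Near cops′ y
      watched-near (inj₁ (i , _ , i~y)) = suc i , i~y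
      watched-near (inj₂ refl) = zero , inj₁ refl

      lead-near : ∀ {y} → Step G (s 0) y → y ∈ D → Near cops′ y
      lead-near (inj₁ refl) _ = zero , inj₂ (Edge-sym c-w)
      lead-near (inj₂ c-y) y∈D = watched-near (guard-lead y∈D c-y)

      exit-near : ∀ {y} → Guarded k g y ⊎ y ≡ s 0 → Near cops′ y
      exit-near (inj₁ guarded) = watched-near (inj₁ (keep-guard guarded))
      exit-near (inj₂ refl) = zero , inj₂ (Edge-sym c-w)

      exits′ : ∀ {x y} → x ∈ D′ → Edge G x y → y ∉ D′ → Guarded k′ g′ y ⊎ y ≡ w
      exits′ {x} {y} x∈D′ x-y y∉D′ with ∈∖N[]⁻ x∈D′ | y ∈? D | step? (s 0) y
      ... | x∈D , ¬c~x | no y∉D | _ = still-watched (exits x∈D x-y y∉D)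
        where
        still-watched : Guarded k g y ⊎ y ≡ s 0 → Guarded k′ g′ y ⊎ y ≡ w
        still-watched (inj₁ guarded) = inj₁ (keep-guard guarded)
        still-watched (inj₂ y≡c) = ⊥-elim (¬c~x (inj₂ (Edge-sym (subst (Edge G x) y≡c x-y))))
      ... | _ | yes y∈D | no ¬c~y = ⊥-elim (y∉D′ (∈∖N[]⁺ y∈D ¬c~y))
      ... | _ , ¬c~x | yes _ | yes (inj₁ refl) = ⊥-elim (¬c~x (inj₂ (Edge-sym x-y)))
      ... | _ | yes y∈D | yes (inj₂ c-y) = guard-lead y∈D c-y

      survives : ∀ {r′} → Step G r r′ → ¬ Near cops′ r′ → Invariant k′ g′ D′ (prepend w s) r′
      survives {r′} r~r′ escaped′ = record
        { k≤l = k′≤l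
        ; idle = arrive
        ; path = IsInducedPath-≤ k′≤1+k (IsInducedPath-prepend path (Edge-sym c-w) (far w∈D))
        ; far = far′
        ; exits = exits′
        ; robber∈D = r′∈D′
        ; robber-walk = v , walk′ r~r′ , inj₂ (Edge-sym v-w)
        }
        where
        far′ : ∀ {x} → x ∈ D′ → FarFromTail k′ (prepend w s) x
        far′ x∈D′ with ∈∖N[]⁻ x∈D′
        ... | x∈D , ¬c~x = FarFromTail-≤ {s = prepend w s} k′≤1+k (FarFromTail-prepend {s = s} {w} ¬c~x (far x∈D))

        r∈D′ : r ∈ D′
        r∈D′ = ∈∖N[]⁺ robber∈D (escaped ∘ (zero ,_))

        r′∈D : Step G r r′ → r′ ∈ D
        r′∈D (inj₁ refl) = robber∈D
        r′∈D (inj₂ r-r′) with r′ ∈? D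
        ... | yes r′∈D = r′∈D
        ... | no r′∉D = ⊥-elim (escaped′ (exit-near (exits robber∈D r-r′ r′∉D)))

        r′∈D′ : r′ ∈ D′
        r′∈D′ = ∈∖N[]⁺ (r′∈D r~r′) (λ c~r′ → escaped′ (lead-near c~r′ (r′∈D r~r′)))

        walk′ : Step G r r′ → Walk D′ r′ v
        walk′ (inj₁ refl) = walk
        walk′ (inj₂ r-r′) = (Edge-sym r-r′ , r∈D′) ◅ walk

    chase : ∀ {k g D s r} → Acc _<_ ∣ D ∣ → Invariant k g D s r → CopTurn G (s 0 ∷ g) r
    chase {g = g} {s = s} {r = r} (acc smaller) I with near? (s 0 ∷ g) r
    ... | yes near = capture near
    ... | no escaped = moveC cops′ cops-step (moveR respond)
      where
      open Round I escaped
      respond : ∀ r′ → Step G r r′ → CopTurn G cops′ r′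
      respond r′ r~r′ with near? cops′ r′
      ... | yes near = capture near
      ... | no escaped′ = chase (smaller (p⊂q⇒∣p∣<∣q∣ shrinks)) (survives r~r′ escaped′)

    start : Connected G → ∀ v r → Invariant 0 (const v) ⊤ (const v) r
    start connected v r = record
      { k≤l = z≤n
      ; idle = λ _ _ → refl
      ; path = IsInducedPath-zero (const v)
      ; far = λ _ ()
      ; exits = λ _ _ y∉⊤ → ⊥-elim (y∉⊤ ∈⊤)
      ; robber∈D = ∈⊤
      ; robber-walk = v , Reachable⇒Walk (connected r v) , inj₁ refl
      }

    copsWin : Connected G → Fin n → CopsWin G (suc l)
    copsWin connected v = (v ∷ const v) , λ r → chase (<-wellFounded _) (start connected v r)

theorem2 : (l : ℕ) → 1 ≤ l → {n : ℕ} (G : SimpleGraph n) → Connected G →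
           ¬ InducedSub G (H1 l) → ¬ InducedSub G (H2 l) →
           CopNumber≤ G (l + 1)
theorem2 l _ {zero} G _ _ _ = 0 , z≤n , (λ ()) , λ ()
theorem2 l _ {suc m} G connected ¬H1 ¬H2 =
  suc l , ≤-reflexive (+-comm 1 l) , Strategy.copsWin G l [ ¬H1 , ¬H2 ] connected zero
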